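{- Let $n \geq 1$ be an integer, let $\mathbf{S}$ be a distributive meet semilattice and let $F \subseteq \mathbf{S}$ be an upset. The following are equivalent: (i) $F$ is a prime $n$-filter of $\mathbf{S}$; (ii) $F$ is a prime upset which is a union of at most $n$ filters of $\mathbf{S}$; (iii) $F$ is a prime upset and there is a meet-semilattice homomorphism $h\colon \mathbf{S} \to \mathbf{2}^n$ with $F = h^{ -1}[P_n]$.
   Context: A meet semilattice $\mathbf{S}$ is distributive if whenever $x \wedge y \leq z$ there exist $x' \geq x$, $y' \geq y$ with $x' \wedge y' = z$. For an integer $n \geq 1$, an $n$-filter of $\mathbf{S}$ is an upset $F$ such that for every non-empty finite $X \subseteq \mathbf{S}$: if $\bigwedge Y \in F$ for all $Y \subseteq X$ with $1 \leq |Y| \leq n$, then $\bigwedge X \in F$. A filter is a $1$-filter (the empty set allowed). An $n$-filter $F$ is prime if it is meet-prime in the lattice of $n$-filters ordered by inclusion: $G \cap H \subseteq F$ for $n$-filters $G,H$ implies $G \subseteq F$ or $H \subseteq F$. An upset $F$ is prime if its complement is upward directed (possibly empty): for any $x, y \notin F$ there is $z \notin F$ with $x, y \leq z$. $\mathbf{2}^n$ is the $n$-th power of the two-element lattice $\{0<1\}$, viewed as a meet semilattice, and $P_n = \{x \in \mathbf{2}^n : x \neq 0\}$. -}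

module Defs where

open import Level using (Level; _⊔_)
open import Data.Nat using (ℕ; zero; suc; _≤_)
open import Data.Fin using (Fin)
import Data.Fin as Fin
open import Data.Bool using (Bool; true; false) renaming (_∧_ to _∧ᵇ_)
open import Data.Product using (Σ; ∃; _×_; _,_)
open import Data.Sum using (_⊎_)
open import Relation.Nullary using (¬_)
open import Relation.Unary using (Pred; _⊆_)
open import Relation.Binary.PropositionalEquality using (_≡_)
open import Relation.Binary.Lattice using (MeetSemilattice)

private
  variable
    c ℓ₁ ℓ₂ : Level

module _ (S : MeetSemilattice c ℓ₁ ℓ₂) where
  open MeetSemilattice S renaming (_≤_ to _⊑_)

  Distributive : Set (c ⊔ ℓ₁ ⊔ ℓ₂)
  Distributive = ∀ x y z → (x ∧ y) ⊑ z →
    Σ Carrier λ x' → Σ Carrier λ y' → x ⊑ x' × y ⊑ y' × (x' ∧ y') ≈ z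

  ⋀ : ∀ {k} → (Fin (suc k) → Carrier) → Carrier
  ⋀ {zero}  x = x Fin.zero
  ⋀ {suc k} x = x Fin.zero ∧ ⋀ (λ i → x (Fin.suc i))

  IsUpset : ∀ {ℓ} → Pred Carrier ℓ → Set (c ⊔ ℓ₂ ⊔ ℓ)
  IsUpset F = ∀ {x y} → x ⊑ y → F x → F y

  -- A subfamily with at most n members
  -- is given by a map f : Fin (suc m) → Fin (suc k) with suc m ≤ n
  -- (repetitions are harmless since meets are idempotent).
  IsNFilter : ∀ {ℓ} → ℕ → Pred Carrier ℓ → Set (c ⊔ ℓ₂ ⊔ ℓ)
  IsNFilter n F = IsUpset F ×
    (∀ k (x : Fin (suc k) → Carrier) →
       (∀ m → suc m ≤ n → (f : Fin (suc m) → Fin (suc k)) →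
          F (⋀ (λ i → x (f i)))) →
       F (⋀ x))

  -- A filter is a 1-filter (the empty set allowed).
  IsFilter : ∀ {ℓ} → Pred Carrier ℓ → Set (c ⊔ ℓ₂ ⊔ ℓ)
  IsFilter = IsNFilter 1

  -- Prime n-filter: meet-prime in the lattice of n-filters (ordered by
  -- inclusion), whose meet is intersection.
  IsPrimeNFilter : ∀ {ℓ} → ℕ → Pred Carrier ℓ → Set (Level.suc ℓ ⊔ c ⊔ ℓ₂)
  IsPrimeNFilter {ℓ} n F = IsNFilter n F ×
    ((G H : Pred Carrier ℓ) → IsNFilter n G → IsNFilter n H →
       (∀ {x} → G x → H x → F x) → (G ⊆ F) ⊎ (H ⊆ F))

  IsPrimeUpset : ∀ {ℓ} → Pred Carrier ℓ → Set (c ⊔ ℓ₂ ⊔ ℓ)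
  IsPrimeUpset F = IsUpset F ×
    (∀ x y → ¬ F x → ¬ F y → Σ Carrier λ z → ¬ F z × x ⊑ z × y ⊑ z)

  IsUnionOfAtMost : ∀ {ℓ} → ℕ → Pred Carrier ℓ → Set (Level.suc ℓ ⊔ c ⊔ ℓ₂)
  IsUnionOfAtMost {ℓ} n F = Σ ℕ λ m → m ≤ n × Σ (Fin m → Pred Carrier ℓ) λ G →
    (∀ i → IsFilter (G i)) ×
    (∀ x → (F x → ∃ λ i → G i x) × ((∃ λ i → G i x) → F x))

  -- 2ⁿ = Fin n → Bool with pointwise meet.  A meet-semilattice
  -- homomorphism S → 2ⁿ (equality in 2ⁿ is pointwise).
  IsMeetHom : (n : ℕ) → (Carrier → Fin n → Bool) → Set (c ⊔ ℓ₁)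
  IsMeetHom n h =
    (∀ {x y} → x ≈ y → ∀ i → h x i ≡ h y i) ×
    (∀ x y i → h (x ∧ y) i ≡ (h x i ∧ᵇ h y i))

  -- F = h⁻¹[Pₙ], where Pₙ = 2ⁿ ∖ {0}.
  IsPreimageOfPn : ∀ {ℓ} (n : ℕ) → (Carrier → Fin n → Bool) → Pred Carrier ℓ → Set (c ⊔ ℓ)
  IsPreimageOfPn n h F =
    ∀ x → (F x → ∃ λ i → h x i ≡ true) × ((∃ λ i → h x i ≡ true) → F x)

-- Classically, an upset F is a union of at most n filters iff it contains no n + 1
-- elements with pairwise meets outside F.  If F is a prime n-filter there is no such family
-- (a₀, …, aₙ): directedness of the complement gives one u ∉ F above all aᵢ ∧ aⱼ, and
-- distributivity splits u = b₀ ∧ … ∧ bₙ with aᵢ ≤ bₜ whenever t ≠ i; any n of the bₜ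
-- miss some index s and so lie above aₛ ∈ F, whence the n-filter property puts u in F.
-- For a maximal family (a₀, …, a_{m-1}) the sets {y | y ∧ aⱼ ∈ F} are then m ≤ n
-- filters covering F.  Conversely a union of at most n filters is an n-filter, and a
-- prime upset is meet-prime among all upsets.  Filters G₀, …, G_{n-1} are the
-- coordinates of the homomorphism x ↦ ([x ∈ Gᵢ])ᵢ into 2ⁿ.
module Submission where

open import Defs
open import Level using (Level; _⊔_; Lift; lift; lower)
open import Data.Nat using (ℕ; zero; suc; _≤_; _<_; z≤n; s≤s)
open import Data.Nat.Properties using (≤-refl; m≤n⇒m≤1+n)
open import Data.Fin using (Fin; zero; suc; inject≤; _≟_)
open import Data.Fin.Properties using (any?; ¬∀⟶∃¬; pigeonhole; <⇒≢; inject≤-injective; suc-injective)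
open import Data.Bool using (Bool; true) renaming (_∧_ to _∧ᵇ_)
open import Data.Product using (Σ; ∃; _×_; _,_; proj₁; proj₂; map₁; map₂)
open import Data.Sum using (_⊎_; inj₁; inj₂; [_,_]′)
open import Data.Vec.Functional using (updateAt)
open import Data.Vec.Functional.Properties using (updateAt-updates; updateAt-minimal)
open import Function using (_∘_; const; case_of_)
open import Function.Bundles using (_⇔_; mk⇔)
open import Relation.Nullary using (¬_; yes; no; does; contradiction)
open import Relation.Nullary.Decidable using (True; toWitness; fromWitness; dec-true; dec-false)
open import Relation.Unary using (Pred; _⊆_)
open import Relation.Binary.PropositionalEquality
  using (_≡_; _≢_; refl; sym; trans; cong; cong₂; subst; module ≡-Reasoning)
open import Relation.Binary.Lattice using (MeetSemilattice)
open import Axiom.ExcludedMiddle using (ExcludedMiddle)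
open import Axiom.DoubleNegationElimination using (em⇒dne)
import Relation.Binary.Lattice.Properties.MeetSemilattice as MeetSemilatticeProperties
import Relation.Binary.Reasoning.PartialOrder as PartialOrderReasoning

private
  variable
    a p : Level
    A : Set a

missing-value : ∀ {m n} → m < n → (f : Fin m → Fin n) → ∃ λ s → ∀ i → f i ≢ s
missing-value {n = n} m<n f =
  map₂ (λ unhit i fi≡s → unhit (i , fi≡s)) (¬∀⟶∃¬ n _ (λ s → any? (λ i → f i ≟ s)) λ onto →
    let i , j , i<j , same = pigeonhole m<n (λ s → proj₁ (onto s))
    in <⇒≢ i<j (trans (sym (proj₂ (onto i))) (trans (cong f same) (proj₂ (onto j)))))

updateAt-elim : ∀ {n} (P : Fin n → A → Set p) (xs : Fin n → A) j {f : A → A} →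
  P j (f (xs j)) → (∀ i → i ≢ j → P i (xs i)) → ∀ i → P i (updateAt xs j f i)
updateAt-elim P xs j Pj Pothers i with i ≟ j
... | yes refl = subst (P j) (sym (updateAt-updates j xs)) Pj
... | no i≢j  = subst (P i) (sym (updateAt-minimal i j xs i≢j)) (Pothers i i≢j)

threshold : (∀ {a} → ExcludedMiddle a) → (Q : ℕ → Set p) → ∀ {N} → Q 0 → ¬ Q (suc N) →
  ∃ λ m → m ≤ N × Q m × ¬ Q (suc m)
threshold lem Q {zero}  q₀ ¬q₁ = 0 , z≤n , q₀ , ¬q₁
threshold lem Q {suc N} q₀ ¬qN+2 with lem {P = Q (suc N)}
... | yes qN+1 = suc N , ≤-refl , qN+1 , ¬qN+2
... | no ¬qN+1 = map₂ (map₁ m≤n⇒m≤1+n) (threshold lem Q q₀ ¬qN+1)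

module FilterTheory {c ℓ₁ ℓ₂} (S : MeetSemilattice c ℓ₁ ℓ₂) where
  open MeetSemilattice S
    using (Carrier; _≈_; _∧_; x∧y≤x; x∧y≤y; ∧-greatest; antisym; poset; module Eq)
    renaming (_≤_ to _⊑_; refl to ⊑-refl; trans to ⊑-trans; reflexive to ⊑-reflexive)
  open MeetSemilatticeProperties S using (∧-monotonic; ∧-cong; ∧-comm)

  ≈⇒⊒ : ∀ {x y} → x ≈ y → y ⊑ x
  ≈⇒⊒ = ⊑-reflexive ∘ Eq.sym

  ⋀-lowerBound : ∀ {k} (x : Fin (suc k) → Carrier) i → ⋀ S x ⊑ x i
  ⋀-lowerBound {zero}  x zero    = ⊑-refl
  ⋀-lowerBound {suc k} x zero    = x∧y≤x _ _
  ⋀-lowerBound {suc k} x (suc i) = ⊑-trans (x∧y≤y _ _) (⋀-lowerBound (x ∘ suc) i)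

  ⋀-closed : (G : Pred Carrier p) → (∀ {x y} → G x → G y → G (x ∧ y)) →
    ∀ {k} (x : Fin (suc k) → Carrier) → (∀ i → G (x i)) → G (⋀ S x)
  ⋀-closed G closed {zero}  x inG = inG zero
  ⋀-closed G closed {suc k} x inG = closed (inG zero) (⋀-closed G closed (x ∘ suc) (inG ∘ suc))

  ⋀-greatest : ∀ {k} (x : Fin (suc k) → Carrier) {z} → (∀ i → z ⊑ x i) → z ⊑ ⋀ S x
  ⋀-greatest x = ⋀-closed (_ ⊑_) ∧-greatest x

  ∧-closed⇒IsNFilter : ∀ {n} {G : Pred Carrier p} → 1 ≤ n → IsUpset S G →
    (∀ {x y} → G x → G y → G (x ∧ y)) → IsNFilter S n G
  ∧-closed⇒IsNFilter {G = G} 1≤n upG closed =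
    upG , λ k x singletons → ⋀-closed G closed x (λ i → singletons 0 1≤n (const i))

  filter-⋀ : {G : Pred Carrier p} → IsFilter S G →
    ∀ {k} (x : Fin (suc k) → Carrier) → (∀ i → G (x i)) → G (⋀ S x)
  filter-⋀ (_ , closed) x inG = closed _ x λ { zero _ f → inG (f zero) ; (suc _) (s≤s ()) _ }

  filter-∧ : {G : Pred Carrier p} → IsFilter S G → ∀ {x y} → G x → G y → G (x ∧ y)
  filter-∧ filter {x} {y} gx gy =
    filter-⋀ filter {k = 1} (λ { zero → x ; (suc _) → y }) (λ { zero → gx ; (suc zero) → gy })

  IsUnionOf : ∀ {m} → (Fin m → Pred Carrier p) → Pred Carrier p → Set (c ⊔ p)
  IsUnionOf G F = ∀ x → (F x → ∃ λ i → G i x) × ((∃ λ i → G i x) → F x)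

  meetHom-monotone : ∀ {n h} → IsMeetHom S n h →
    ∀ {x y} → x ⊑ y → ∀ i → h x i ≡ true → h y i ≡ true
  meetHom-monotone {h = h} (respects , homomorphic) {x} {y} x⊑y i hx≡true = begin
    h y i           ≡⟨ cong (_∧ᵇ h y i) hx≡true ⟨
    h x i ∧ᵇ h y i  ≡⟨ homomorphic x y i ⟨
    h (x ∧ y) i     ≡⟨ respects (antisym (x∧y≤x x y) (∧-greatest ⊑-refl x⊑y)) i ⟩
    h x i           ≡⟨ hx≡true ⟩
    true            ∎
    where open ≡-Reasoning

  preimage⇒union : ∀ {ℓ n} {F : Pred Carrier ℓ} →
    Σ (Carrier → Fin n → Bool) (λ h → IsMeetHom S n h × IsPreimageOfPn S n h F) →
    IsUnionOfAtMost S n F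
  preimage⇒union {ℓ} {n} (h , hom@(_ , homomorphic) , preimage) = n , ≤-refl , G , isFilter , isUnion
    where
    G : Fin n → Pred Carrier ℓ
    G i y = Lift ℓ (h y i ≡ true)
    isFilter : ∀ i → IsFilter S (G i)
    isFilter i = ∧-closed⇒IsNFilter ≤-refl
      (λ x⊑y → lift ∘ meetHom-monotone hom x⊑y i ∘ lower)
      (λ {x} {y} gx gy → lift (trans (homomorphic x y i) (cong₂ _∧ᵇ_ (lower gx) (lower gy))))
    isUnion : IsUnionOf G _
    isUnion x = map₂ lift ∘ proj₁ (preimage x) , λ (i , g) → proj₂ (preimage x) (i , lower g)

  pad : ∀ {m n} → m ≤ n → (Fin m → Pred Carrier p) → Fin n → Pred Carrier p
  pad m≤n G i x = ∃ λ j → inject≤ j m≤n ≡ i × G j x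

  pad-IsFilter : ∀ {m n} (m≤n : m ≤ n) {G : Fin m → Pred Carrier p} →
    (∀ j → IsFilter S (G j)) → ∀ i → IsFilter S (pad m≤n G i)
  pad-IsFilter m≤n {G} filters i = ∧-closed⇒IsNFilter ≤-refl
    (λ x⊑y (j , e , g) → j , e , proj₁ (filters j) x⊑y g)
    (λ { {y = y} (j , refl , gx) (j′ , e′ , gy) →
          j , refl , filter-∧ (filters j) gx
                       (subst (λ t → G t y) (inject≤-injective m≤n m≤n j′ j e′) gy) })

  pad-IsUnionOf : ∀ {m n} (m≤n : m ≤ n) {G : Fin m → Pred Carrier p} {F : Pred Carrier p} →
    IsUnionOf G F → IsUnionOf (pad m≤n G) F
  pad-IsUnionOf m≤n union x =
    (λ fx → let j , g = proj₁ (union x) fx in inject≤ j m≤n , j , refl , g) ,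
    (λ (_ , j , _ , g) → proj₂ (union x) (j , g))

  module _ (dist : Distributive S) where
    open PartialOrderReasoning poset

    ∧-residual-directed : ∀ {w u x y} → x ∧ w ⊑ u → y ∧ w ⊑ u →
      ∃ λ z → x ⊑ z × y ⊑ z × z ∧ w ⊑ u
    ∧-residual-directed {w} {u} {x} {y} x∧w⊑u y∧w⊑u =
      let x′ , w₁ , x⊑x′ , w⊑w₁ , x′∧w₁≈u = dist x w u x∧w⊑u
          u⊑x′ = ⊑-trans (≈⇒⊒ x′∧w₁≈u) (x∧y≤x _ _)
          y′ , w₂ , y⊑y′ , w⊑w₂ , y′∧w₂≈x′ = dist y w x′ (⊑-trans y∧w⊑u u⊑x′)
          x′⊑y′ = ⊑-trans (≈⇒⊒ y′∧w₂≈x′) (x∧y≤x _ _)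
      in y′ , ⊑-trans x⊑x′ x′⊑y′ , y⊑y′ , (begin
        y′ ∧ w          ≤⟨ ∧-greatest (∧-monotonic ⊑-refl w⊑w₂) (⊑-trans (x∧y≤y _ _) w⊑w₁) ⟩
        (y′ ∧ w₂) ∧ w₁  ≈⟨ ∧-cong y′∧w₂≈x′ Eq.refl ⟩
        x′ ∧ w₁         ≈⟨ x′∧w₁≈u ⟩
        u               ∎)

    ∧-residual-bound : ∀ {K w u} (x : Fin K → Carrier) → (∀ i → x i ∧ w ⊑ u) →
      ∃ λ z → (∀ i → x i ⊑ z) × z ∧ w ⊑ u
    ∧-residual-bound {zero} {u = u} x _ = u , (λ ()) , x∧y≤x _ _
    ∧-residual-bound {suc K} x below =
      let z₁ , tail⊑z₁ , z₁∧w⊑u = ∧-residual-bound (x ∘ suc) (below ∘ suc)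
          z , x₀⊑z , z₁⊑z , z∧w⊑u = ∧-residual-directed (below zero) z₁∧w⊑u
      in z , (λ { zero → x₀⊑z ; (suc i) → ⊑-trans (tail⊑z₁ i) z₁⊑z }) , z∧w⊑u

    separating-⋀ : ∀ {k u} (a : Fin (suc k) → Carrier) → (∀ i j → i ≢ j → a i ∧ a j ⊑ u) →
      ∃ λ b → (∀ t i → t ≢ i → a i ⊑ b t) × ⋀ S b ≈ u
    separating-⋀ {zero} {u} a _ = const u , (λ { zero zero 0≢0 → contradiction refl 0≢0 }) , Eq.refl
    separating-⋀ {suc k} {u} a below =
      let z , tail⊑z , z∧a₀⊑u = ∧-residual-bound (a ∘ suc) (λ i → below (suc i) zero λ ())
          z′ , a₀′ , z⊑z′ , a₀⊑a₀′ , z′∧a₀′≈u = dist z (a zero) u z∧a₀⊑u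
          u⊑a₀′ = ⊑-trans (≈⇒⊒ z′∧a₀′≈u) (x∧y≤y _ _)
          b′ , separates′ , ⋀b′≈a₀′ = separating-⋀ (a ∘ suc)
            (λ i j i≢j → ⊑-trans (below (suc i) (suc j) (i≢j ∘ suc-injective)) u⊑a₀′)
          b : Fin (suc (suc k)) → Carrier
          b = λ { zero → z′ ; (suc t) → b′ t }
          separates : ∀ t i → t ≢ i → a i ⊑ b t
          separates = λ
            { zero    zero    0≢0 → contradiction refl 0≢0
            ; zero    (suc i) _   → ⊑-trans (tail⊑z i) z⊑z′
            ; (suc t) zero    _   → ⊑-trans a₀⊑a₀′ (⊑-trans (≈⇒⊒ ⋀b′≈a₀′) (⋀-lowerBound b′ t))
            ; (suc t) (suc i) t≢i → separates′ t i (t≢i ∘ cong suc) }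
      in b , separates , Eq.trans (∧-cong Eq.refl ⋀b′≈a₀′) z′∧a₀′≈u

  reach-all-outside : ∀ {ℓ K} {F : Pred Carrier ℓ} (Goal : Fin K → Pred Carrier p) →
    (∀ i → IsUpset S (Goal i)) → (∀ i u → ¬ F u → ∃ λ v → ¬ F v × u ⊑ v × Goal i v) →
    ∀ u → ¬ F u → ∃ λ v → ¬ F v × u ⊑ v × ∀ i → Goal i v
  reach-all-outside {K = zero} Goal _ _ u u∉F = u , u∉F , ⊑-refl , λ ()
  reach-all-outside {K = suc K} Goal upGoal reach u u∉F =
    let v , v∉F , u⊑v , goal₀ = reach zero u u∉F
        w , w∉F , v⊑w , goals = reach-all-outside (Goal ∘ suc) (upGoal ∘ suc) (reach ∘ suc) v v∉F
    in w , w∉F , ⊑-trans u⊑v v⊑w , λ { zero → upGoal zero v⊑w goal₀ ; (suc i) → goals i }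

  pairwise-meets-bound : ∀ {ℓ} {F : Pred Carrier ℓ} → IsPrimeUpset S F →
    ∀ {K} (a : Fin K → Carrier) → (∀ i j → i ≢ j → ¬ F (a i ∧ a j)) →
    ∀ u → ¬ F u → ∃ λ v → ¬ F v × u ⊑ v × (∀ i j → i ≢ j → a i ∧ a j ⊑ v)
  pairwise-meets-bound {F = F} (_ , directed) a incompatible =
    reach-all-outside _ (λ i u⊑v below j i≢j → ⊑-trans (below j i≢j) u⊑v)
      (λ i → reach-all-outside _ (λ j u⊑v below i≢j → ⊑-trans (below i≢j) u⊑v) (row i))
    where
    row : ∀ i j u → ¬ F u → ∃ λ v → ¬ F v × u ⊑ v × (i ≢ j → a i ∧ a j ⊑ v)
    row i j u u∉F with i ≟ j
    ... | yes i≡j = u , u∉F , ⊑-refl , contradiction i≡j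
    ... | no i≢j  =
      let v , v∉F , u⊑v , aᵢ∧aⱼ⊑v = directed u (a i ∧ a j) u∉F (incompatible i j i≢j)
      in v , v∉F , u⊑v , const aᵢ∧aⱼ⊑v

  IncompatibleFamily : Pred Carrier p → ℕ → Set (c ⊔ p)
  IncompatibleFamily F m =
    Σ (Fin m → Carrier) λ a → (∀ i → F (a i)) × (∀ i j → i ≢ j → ¬ F (a i ∧ a j))

  module _ {ℓ} {F : Pred Carrier ℓ} (upF : IsUpset S F) where

    incompatible-cons : ∀ {m} ((a , _) : IncompatibleFamily F m) {w} → F w →
      (∀ i → ¬ F (w ∧ a i)) → IncompatibleFamily F (suc m)
    incompatible-cons (a , a∈F , incompatible) {w} w∈F w-incompatible = b , b∈F , b-incompatible
      where
      b : Fin (suc _) → Carrier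
      b zero    = w
      b (suc i) = a i
      b∈F : ∀ i → F (b i)
      b∈F zero    = w∈F
      b∈F (suc i) = a∈F i
      b-incompatible : ∀ i j → i ≢ j → ¬ F (b i ∧ b j)
      b-incompatible zero    zero    0≢0 = contradiction refl 0≢0
      b-incompatible zero    (suc j) _   = w-incompatible j
      b-incompatible (suc i) zero    _   = w-incompatible i ∘ upF (⊑-reflexive (∧-comm _ _))
      b-incompatible (suc i) (suc j) i≢j = incompatible i j (i≢j ∘ cong suc)

    incompatible-shrink : ∀ {m} ((a , _) : IncompatibleFamily F m) (b : Fin m → Carrier) →
      (∀ i → b i ⊑ a i) → (∀ i → F (b i)) → IncompatibleFamily F m
    incompatible-shrink (_ , _ , incompatible) b b⊑a b∈F =
      b , b∈F , λ i j i≢j → incompatible i j i≢j ∘ upF (∧-monotonic (b⊑a i) (b⊑a j))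

    no-large-incompatible-family : Distributive S → ∀ {n} → 1 ≤ n →
      IsPrimeUpset S F → IsNFilter S n F → ¬ IncompatibleFamily F (suc n)
    no-large-incompatible-family dist {suc n} (s≤s z≤n) prime (_ , nFilter) (a , a∈F , incompatible) =
      let u , u∉F , _ , meets⊑u = pairwise-meets-bound prime a incompatible
            (a zero ∧ a (suc zero)) (incompatible zero (suc zero) λ ())
          b , separates , ⋀b≈u = separating-⋀ dist a meets⊑u
          ⋀b∈F = nFilter (suc n) b λ _ size≤n f →
            let s , f≢s = missing-value (s≤s size≤n) f
            in upF (⋀-greatest _ (λ i → separates (f i) s (f≢s i))) (a∈F s)
      in u∉F (upF (⊑-reflexive ⋀b≈u) ⋀b∈F)

  module Classical (lem : ∀ {a} → ExcludedMiddle a) where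

    dne : ¬ ¬ A → A
    dne = em⇒dne lem

    ¬∀⇒∃¬ : {P : A → Set p} → ¬ (∀ x → P x) → ∃ λ x → ¬ P x
    ¬∀⇒∃¬ ¬∀ = dne λ ¬∃ → ¬∀ λ x → dne λ ¬Px → ¬∃ (x , ¬Px)

    χ : ∀ {n} → (Fin n → Pred Carrier p) → Carrier → Fin n → Bool
    χ G x i = does (lem {P = G i x})

    χ-IsMeetHom : ∀ {n} {G : Fin n → Pred Carrier p} → (∀ i → IsFilter S (G i)) → IsMeetHom S n (χ G)
    χ-IsMeetHom {G = G} filters = respects , homomorphic
      where
      up : ∀ i {x y} → x ⊑ y → G i x → G i y
      up i = proj₁ (filters i)
      respects : ∀ {x y} → x ≈ y → ∀ i → χ G x i ≡ χ G y i
      respects {x} {y} x≈y i with lem {P = G i y}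
      ... | yes gy = dec-true lem (up i (≈⇒⊒ x≈y) gy)
      ... | no ¬gy = dec-false lem (¬gy ∘ up i (⊑-reflexive x≈y))
      homomorphic : ∀ x y i → χ G (x ∧ y) i ≡ χ G x i ∧ᵇ χ G y i
      homomorphic x y i with lem {P = G i x} | lem {P = G i y}
      ... | yes gx | yes gy = dec-true lem (filter-∧ (filters i) gx gy)
      ... | no ¬gx | _      = dec-false lem (¬gx ∘ up i (x∧y≤x x y))
      ... | yes _  | no ¬gy = dec-false lem (¬gy ∘ up i (x∧y≤y x y))

    χ-true : ∀ {n} (G : Fin n → Pred Carrier p) {x i} → χ G x i ≡ true → G i x
    χ-true G {x} {i} χ≡true with lem {P = G i x} | χ≡true
    ... | yes g | _ = g

    χ-IsPreimageOfPn : ∀ {n} {G : Fin n → Pred Carrier p} {F : Pred Carrier p} →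
      IsUnionOf G F → IsPreimageOfPn S n (χ G) F
    χ-IsPreimageOfPn {G = G} union x =
      (λ fx → let i , g = proj₁ (union x) fx in i , dec-true lem g) ,
      (λ (i , χ≡true) → proj₂ (union x) (i , χ-true G χ≡true))

    union⇒preimage : ∀ {ℓ n} {F : Pred Carrier ℓ} → IsUnionOfAtMost S n F →
      Σ (Carrier → Fin n → Bool) (λ h → IsMeetHom S n h × IsPreimageOfPn S n h F)
    union⇒preimage (_ , m≤n , G , filters , union) =
      χ (pad m≤n G) ,
      χ-IsMeetHom (pad-IsFilter m≤n filters) ,
      χ-IsPreimageOfPn (pad-IsUnionOf m≤n union)

    module _ {ℓ} {F : Pred Carrier ℓ} (upF : IsUpset S F) where

      -- A member of the family is outside every filter not containing ⋀ x; choosing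
      -- one per filter gives at most n members whose meet is then outside F.
      union-IsNFilter : ∀ {m n} {G : Fin m → Pred Carrier ℓ} → 1 ≤ n → m ≤ n →
        (∀ j → IsFilter S (G j)) → IsUnionOf G F → IsNFilter S n F
      union-IsNFilter {zero} 1≤n _ _ union =
        upF , λ _ x small → case proj₁ (union (x zero)) (small 0 1≤n (const zero)) of λ { (() , _) }
      union-IsNFilter {suc m} {G = G} _ m<n filters union = upF , λ k x small → dne λ ⋀x∉F →
        let avoid : ∀ j → ∃ λ i → ¬ G j (x i)
            avoid j = ¬∀⇒∃¬ λ all∈Gⱼ → ⋀x∉F (proj₂ (union _) (j , filter-⋀ (filters j) x all∈Gⱼ))
            j , inGⱼ = proj₁ (union _) (small m m<n (proj₁ ∘ avoid))
        in proj₂ (avoid j) (proj₁ (filters j) (⋀-lowerBound _ j) inGⱼ)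

      ⊆-or-counterexample : (G : Pred Carrier p) → G ⊆ F ⊎ ∃ λ x → G x × ¬ F x
      ⊆-or-counterexample G with lem {P = ∃ λ x → G x × ¬ F x}
      ... | yes counterexample = inj₂ counterexample
      ... | no none = inj₁ λ {x} gx → dne λ x∉F → none (x , gx , x∉F)

      primeUpset-meetPrime : IsPrimeUpset S F → {G H : Pred Carrier p} → IsUpset S G → IsUpset S H →
        (∀ {x} → G x → H x → F x) → G ⊆ F ⊎ H ⊆ F
      primeUpset-meetPrime (_ , directed) {G} {H} upG upH G∩H⊆F
        with ⊆-or-counterexample G | ⊆-or-counterexample H
      ... | inj₁ G⊆F | _ = inj₁ G⊆F
      ... | inj₂ _ | inj₁ H⊆F = inj₂ H⊆F
      ... | inj₂ (g , gG , g∉F) | inj₂ (h , hH , h∉F) =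
        let z , z∉F , g⊑z , h⊑z = directed g h g∉F h∉F
        in contradiction (G∩H⊆F (upG g⊑z gG) (upH h⊑z hH)) z∉F

      primeUpset⇒primeNFilter : ∀ {n} → IsPrimeUpset S F → IsNFilter S n F → IsPrimeNFilter S n F
      primeUpset⇒primeNFilter prime nFilter =
        nFilter , λ _ _ (upG , _) (upH , _) → primeUpset-meetPrime prime upG upH

      -- Excluded middle resizes x ⊑ y to a proposition of the level of F.
      ↑_ : Carrier → Pred Carrier ℓ
      (↑ x) y = Lift ℓ (True (lem {P = x ⊑ y}))

      ↑-intro : ∀ {x y} → x ⊑ y → (↑ x) y
      ↑-intro = lift ∘ fromWitness

      ↑-elim : ∀ {x y} → (↑ x) y → x ⊑ y
      ↑-elim = toWitness ∘ lower

      ↑-IsNFilter : ∀ {n} → 1 ≤ n → ∀ x → IsNFilter S n (↑ x)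
      ↑-IsNFilter 1≤n x = ∧-closed⇒IsNFilter 1≤n
        (λ y⊑z x⊑y → ↑-intro (⊑-trans (↑-elim x⊑y) y⊑z))
        (λ x⊑y x⊑z → ↑-intro (∧-greatest (↑-elim x⊑y) (↑-elim x⊑z)))

      primeNFilter⇒primeUpset : ∀ {n} → 1 ≤ n → IsPrimeNFilter S n F → IsPrimeUpset S F
      primeNFilter⇒primeUpset 1≤n (_ , meetPrime) = upF , λ x y x∉F y∉F → dne λ noBound →
        [ (λ ↑x⊆F → x∉F (↑x⊆F (↑-intro ⊑-refl))) , (λ ↑y⊆F → y∉F (↑y⊆F (↑-intro ⊑-refl))) ]′
        (meetPrime (↑ x) (↑ y) (↑-IsNFilter 1≤n x) (↑-IsNFilter 1≤n y) λ {z} x⊑z y⊑z →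
          dne λ z∉F → noBound (z , z∉F , ↑-elim x⊑z , ↑-elim y⊑z))

      maximal-incompatible⇒union : ∀ {m} → IncompatibleFamily F m → ¬ IncompatibleFamily F (suc m) →
        Σ (Fin m → Pred Carrier ℓ) λ G → (∀ j → IsFilter S (G j)) × IsUnionOf G F
      maximal-incompatible⇒union fam@(a , a∈F , incompatible) maximal =
        G , (λ j → ∧-closed⇒IsNFilter ≤-refl (λ y⊑z → upF (∧-monotonic y⊑z ⊑-refl)) (closed j)) ,
        λ x → cover x , λ (j , g) → upF (x∧y≤x _ _) g
        where
        G : Fin _ → Pred Carrier ℓ
        G j y = F (y ∧ a j)
        cover : ∀ x → F x → ∃ λ j → G j x
        cover x x∈F = dne λ none → maximal (incompatible-cons upF fam x∈F (λ j → none ∘ (j ,_)))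
        -- Otherwise replacing aⱼ by y ∧ aⱼ and adding z ∧ aⱼ enlarges the family.
        closed : ∀ j {y z} → G j y → G j z → G j (y ∧ z)
        closed j {y} {z} gy gz = dne λ y∧z∉Gⱼ →
          let b = updateAt a j (y ∧_)
              shrunk = incompatible-shrink upF fam b
                (updateAt-elim (λ i v → v ⊑ a i) a j (x∧y≤y _ _) (λ _ _ → ⊑-refl))
                (updateAt-elim (λ _ → F) a j gy (λ i _ → a∈F i))
              z∧aⱼ∧y∧aⱼ⊑y∧z∧aⱼ = ∧-greatest
                (∧-greatest (⊑-trans (x∧y≤y _ _) (x∧y≤x _ _)) (⊑-trans (x∧y≤x _ _) (x∧y≤x _ _)))
                (⊑-trans (x∧y≤x _ _) (x∧y≤y _ _))
          in maximal (incompatible-cons upF shrunk gz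
               (updateAt-elim (λ _ v → ¬ F ((z ∧ a j) ∧ v)) a j
                 (y∧z∉Gⱼ ∘ upF z∧aⱼ∧y∧aⱼ⊑y∧z∧aⱼ)
                 (λ i i≢j → incompatible j i (i≢j ∘ sym) ∘ upF (∧-monotonic (x∧y≤y _ _) ⊑-refl))))

      primeNFilter⇒union : Distributive S → ∀ {n} → 1 ≤ n →
        IsPrimeNFilter S n F → IsUnionOfAtMost S n F
      primeNFilter⇒union dist 1≤n primeNFilter@(nFilter , _) =
        let prime = primeNFilter⇒primeUpset 1≤n primeNFilter
            m , m≤n , fam , maximal = threshold lem (IncompatibleFamily F) ((λ ()) , (λ ()) , (λ ()))
              (no-large-incompatible-family upF dist 1≤n prime nFilter)
            G , filters , union = maximal-incompatible⇒union fam maximal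
        in m , m≤n , G , filters , union

mainTheorem4 : (lem : ∀ {a} → ExcludedMiddle a) →
    ∀ {c ℓ₁ ℓ₂ ℓ} (S : MeetSemilattice c ℓ₁ ℓ₂) → Distributive S →
    (n : ℕ) → 1 ≤ n → (F : Pred (MeetSemilattice.Carrier S) ℓ) → IsUpset S F →
    (IsPrimeNFilter S n F ⇔ (IsPrimeUpset S F × IsUnionOfAtMost S n F)) ×
    (IsPrimeNFilter S n F ⇔
      (IsPrimeUpset S F ×
        Σ (MeetSemilattice.Carrier S → Fin n → Bool)
          (λ h → IsMeetHom S n h × IsPreimageOfPn S n h F)))
mainTheorem4 lem S dist n 1≤n F upF =
  mk⇔ i⇒ii ii⇒i ,
  mk⇔ (map₂ union⇒preimage ∘ i⇒ii) (ii⇒i ∘ map₂ preimage⇒union)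
  where
  open FilterTheory S using (module Classical; preimage⇒union)
  open Classical lem

  i⇒ii : IsPrimeNFilter S n F → IsPrimeUpset S F × IsUnionOfAtMost S n F
  i⇒ii primeNFilter =
    primeNFilter⇒primeUpset upF 1≤n primeNFilter , primeNFilter⇒union upF dist 1≤n primeNFilter

  ii⇒i : IsPrimeUpset S F × IsUnionOfAtMost S n F → IsPrimeNFilter S n F
  ii⇒i (prime , m , m≤n , G , filters , union) =
    primeUpset⇒primeNFilter upF prime (union-IsNFilter upF 1≤n m≤n filters union)
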